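{- Let $\lambda$ be a nonzero real number and let $\big(a_n(x\mid\lambda)\big)_{n\ge 0}$ be a sequence (depending on a variable $x$ and on $\lambda$). Define the degenerate Euler--Seidel matrix $\big(a_{k,n}(x\mid\lambda)\big)_{k,n\ge 0}$ recursively by $$a_{0,n}(x\mid\lambda)=a_n(x\mid\lambda)\quad (n\ge 0),$$ $$a_{k,n}(x\mid\lambda)=\bigl(1-(k-n)\lambda\bigr)\,a_{k-1,n}(x\mid\lambda)+a_{k-1,n+1}(x\mid\lambda)\quad (n\ge 0,\ k\ge 1).$$ Then for all $n\ge 0$, $$a_{n,0}(x\mid\lambda)=\sum_{k=0}^{n}\binom{n}{k}(1-\lambda)_{n-k,\lambda}\,a_{0,k}(x\mid\lambda),$$ and $$a_{0,n}(x\mid\lambda)=\sum_{k=0}^{n}\binom{n}{k}(-1)^{n-k}\langle 1-\lambda\rangle_{n-k,\lambda}\,a_{k,0}(x\mid\lambda).$$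
   Context: The degenerate falling factorial is $(y)_{0,\lambda}=1$ and $(y)_{n,\lambda}=y(y-\lambda)(y-2\lambda)\cdots(y-(n-1)\lambda)$ for $n\ge 1$. The degenerate rising factorial is $\langle y\rangle_{0,\lambda}=1$ and $\langle y\rangle_{n,\lambda}=y(y+\lambda)(y+2\lambda)\cdots(y+(n-1)\lambda)$ for $n\ge 1$. -}

module Defs where

open import Level using (Level)
open import Data.Nat using (ℕ; zero; suc)
open import Data.Nat.Combinatorics using (_C_)
open import Algebra.Bundles using (CommutativeRing)

-- All definitions are over an arbitrary commutative ring R
-- (the paper works over ℝ).
module _ {c ℓ : Level} (R : CommutativeRing c ℓ) where
  open CommutativeRing R

  natCast : ℕ → Carrier
  natCast zero    = 0#
  natCast (suc n) = 1# + natCast n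

  pow : Carrier → ℕ → Carrier
  pow x zero    = 1#
  pow x (suc n) = pow x n * x

  sumTo : ℕ → (ℕ → Carrier) → Carrier
  sumTo zero    f = f 0
  sumTo (suc n) f = sumTo n f + f (suc n)

  degFall : Carrier → Carrier → ℕ → Carrier
  degFall λ' y zero    = 1#
  degFall λ' y (suc n) = degFall λ' y n * (y - natCast n * λ')

  degRise : Carrier → Carrier → ℕ → Carrier
  degRise λ' y zero    = 1#
  degRise λ' y (suc n) = degRise λ' y n * (y + natCast n * λ')

  -- degenerate Euler–Seidel matrix: eulerSeidel λ a k n = a_{k,n}(x | λ)
  --   a_{0,n} = a_n
  --   a_{k,n} = (1 - (k - n) λ) a_{k-1,n} + a_{k-1,n+1}   (k ≥ 1)
  -- where (1 - (k-n)λ) is written as 1 - kλ + nλ (k - n may be negative).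
  eulerSeidel : Carrier → (ℕ → Carrier) → ℕ → ℕ → Carrier
  eulerSeidel λ' a zero    n = a n
  eulerSeidel λ' a (suc k) n =
    ((1# - natCast (suc k) * λ') + natCast n * λ') * eulerSeidel λ' a k n
    + eulerSeidel λ' a k (suc n)

{-# OPTIONS --safe #-}

-- For a sequence x and y_q = y₀ + qλ, the sums
--   S p q = Σ_j C(p,j) (y_q)_{p-j,λ} x_{q+j}
-- satisfy S 0 q = x_q and S (p+1) q = (y_q - pλ) S p q + S p (q+1): this is a
-- Pascal rule for the coefficients C(p,j) (y)_{p-j,λ}, resting on the
-- absorption identity C(p,j) (p-j) = C(p,j+1) (j+1).  A recurrence of this
-- shape determines a matrix from its first row.  The Euler–Seidel matrix
-- satisfies it with y₀ = 1 - λ, which gives the first formula.  Solving the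
-- defining recurrence for a_{k,n+1} shows that the transposed matrix satisfies
-- it with y₀ = -(1 - λ), and (-y)_{m,λ} = (-1)^m ⟨y⟩_{m,λ} gives the second.

module Submission where

open import Defs
open import Level using (Level)
open import Data.Nat using (ℕ; _∸_)
open import Data.Nat.Combinatorics using (_C_)
open import Data.Product using (_×_)
open import Relation.Nullary using (¬_)
open import Algebra.Bundles using (CommutativeRing)

open import Data.Nat as ℕ using (zero; suc; _≤_)
open import Data.Nat.Combinatorics using (nC1≡n; nCn≡1; k>n⇒nCk≡0; nCk+nC[k+1]≡[n+1]C[k+1])
open import Data.Product using (_,_)
open import Data.Sum using (inj₁; inj₂)
open import Data.Integer as ℤ using (ℤ; +_; -[1+_]; +[1+_])
open import Data.Maybe using (Maybe; just; nothing)
open import Relation.Nullary using (yes; no)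
open import Relation.Binary.PropositionalEquality as ≡ using (_≡_; cong)

import Data.Nat.Properties as ℕ
import Data.Integer.Properties as ℤ

module _ where
  open import Data.Nat using (_+_; _*_)
  open ≡.≡-Reasoning

  nCk*[n∸k]≡nC[1+k]*[1+k] : ∀ n k → (n C k) * (n ∸ k) ≡ (n C suc k) * suc k
  nCk*[n∸k]≡nC[1+k]*[1+k] zero    zero    = ≡.refl
  nCk*[n∸k]≡nC[1+k]*[1+k] zero    (suc k) = ≡.refl
  nCk*[n∸k]≡nC[1+k]*[1+k] (suc n) zero    =
    ≡.trans (ℕ.*-identityˡ (suc n)) (≡.sym (≡.trans (ℕ.*-identityʳ _) (nC1≡n (suc n))))
  nCk*[n∸k]≡nC[1+k]*[1+k] (suc n) (suc k) = begin
    (suc n C suc k) * (n ∸ k)                           ≡⟨ cong (_* (n ∸ k)) (nCk+nC[k+1]≡[n+1]C[k+1] n k) ⟨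
    ((n C k) + c) * (n ∸ k)                             ≡⟨ ℕ.*-distribʳ-+ (n ∸ k) (n C k) c ⟩
    (n C k) * (n ∸ k) + c * (n ∸ k)                     ≡⟨ ≡.cong₂ _+_ (nCk*[n∸k]≡nC[1+k]*[1+k] n k) c*[n∸k] ⟩
    c * suc k + (c + c * (n ∸ suc k))                   ≡⟨ ℕ.+-assoc (c * suc k) c _ ⟨
    c * suc k + c + c * (n ∸ suc k)                     ≡⟨ cong (_+ c * (n ∸ suc k)) (ℕ.+-comm (c * suc k) c) ⟩
    c + c * suc k + c * (n ∸ suc k)                     ≡⟨ cong (_+ c * (n ∸ suc k)) (ℕ.*-suc c (suc k)) ⟨
    c * suc (suc k) + c * (n ∸ suc k)                   ≡⟨ cong (λ t → c * suc (suc k) + t) (nCk*[n∸k]≡nC[1+k]*[1+k] n (suc k)) ⟩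
    c * suc (suc k) + (n C suc (suc k)) * suc (suc k)   ≡⟨ ℕ.*-distribʳ-+ (suc (suc k)) c _ ⟨
    (c + (n C suc (suc k))) * suc (suc k)               ≡⟨ cong (_* suc (suc k)) (nCk+nC[k+1]≡[n+1]C[k+1] n (suc k)) ⟩
    (suc n C suc (suc k)) * suc (suc k)                 ∎
    where
    c = n C suc k
    c*[n∸k] : c * (n ∸ k) ≡ c + c * (n ∸ suc k)
    c*[n∸k] with k ℕ.<? n
    ... | yes k<n = ≡.trans (cong (c *_) (ℕ.+-∸-assoc 1 k<n)) (ℕ.*-suc c _)
    ... | no k≮n  = ≡.subst (λ c → c * (n ∸ k) ≡ c + c * (n ∸ suc k))
                      (≡.sym (k>n⇒nCk≡0 (ℕ.s≤s (ℕ.≮⇒≥ k≮n)))) ≡.refl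

module IntegerCoefficients {c ℓ : Level} (R : CommutativeRing c ℓ) where
  open CommutativeRing R
  open import Algebra.Properties.Monoid.Mult.TCOptimised +-monoid using (1+×) renaming (_×_ to _×′_)
  open import Algebra.Properties.Group +-group using (ε⁻¹≈ε; ⁻¹-involutive)
  open import Algebra.Properties.AbelianGroup +-abelianGroup using (⁻¹-∙-comm)
  open import Algebra.Properties.Ring ring using (-‿distribˡ-*)
  open import Algebra.Solver.Ring.AlmostCommutativeRing
    using (_-Raw-AlmostCommutative⟶_; fromCommutativeRing)
  open import Relation.Binary.Reasoning.Setoid setoid

  -- The optimised _×′_ makes fromℤ (+ 1) reduce to 1#, so that con (+ 1)
  -- denotes 1# on the nose in solver expressions.
  fromℤ : ℤ → Carrier
  fromℤ (+ n)    = n ×′ 1#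
  fromℤ -[1+ n ] = - (suc n ×′ 1#)

  fromℤ-homo-neg : ∀ i → fromℤ (ℤ.- i) ≈ - fromℤ i
  fromℤ-homo-neg (+ zero)   = sym ε⁻¹≈ε
  fromℤ-homo-neg +[1+ n ]   = refl
  fromℤ-homo-neg -[1+ n ]   = sym (⁻¹-involutive _)

  fromℤ-homo-suc : ∀ i → fromℤ (ℤ.suc i) ≈ 1# + fromℤ i
  fromℤ-homo-suc (+ n)          = 1+× n 1#
  fromℤ-homo-suc -[1+ zero ]    = sym (-‿inverseʳ 1#)
  fromℤ-homo-suc -[1+ suc n ]   = begin
    - (suc n ×′ 1#)                ≈⟨ +-identityˡ _ ⟨
    0# - suc n ×′ 1#               ≈⟨ +-congʳ (-‿inverseʳ 1#) ⟨
    1# - 1# - suc n ×′ 1#          ≈⟨ +-assoc _ _ _ ⟩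
    1# + (- 1# - suc n ×′ 1#)      ≈⟨ +-congˡ (⁻¹-∙-comm _ _) ⟩
    1# - (1# + suc n ×′ 1#)        ≈⟨ +-congˡ (-‿cong (1+× (suc n) 1#)) ⟨
    1# - suc (suc n) ×′ 1#         ∎

  fromℤ-homo-+ⁿ : ∀ m j → fromℤ (+ m ℤ.+ j) ≈ fromℤ (+ m) + fromℤ j
  fromℤ-homo-+ⁿ zero    j = trans (reflexive (cong fromℤ (ℤ.+-identityˡ j))) (sym (+-identityˡ _))
  fromℤ-homo-+ⁿ (suc m) j = begin
    fromℤ (+[1+ m ] ℤ.+ j)          ≡⟨ cong fromℤ (ℤ.suc-+ m j) ⟩
    fromℤ (ℤ.suc (+ m ℤ.+ j))       ≈⟨ fromℤ-homo-suc (+ m ℤ.+ j) ⟩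
    1# + fromℤ (+ m ℤ.+ j)          ≈⟨ +-congˡ (fromℤ-homo-+ⁿ m j) ⟩
    1# + (fromℤ (+ m) + fromℤ j)    ≈⟨ +-assoc _ _ _ ⟨
    1# + fromℤ (+ m) + fromℤ j      ≈⟨ +-congʳ (1+× m 1#) ⟨
    fromℤ +[1+ m ] + fromℤ j        ∎

  fromℤ-homo-+ : ∀ i j → fromℤ (i ℤ.+ j) ≈ fromℤ i + fromℤ j
  fromℤ-homo-+ (+ m)    j = fromℤ-homo-+ⁿ m j
  fromℤ-homo-+ -[1+ m ] j = begin
    fromℤ (-[1+ m ] ℤ.+ j)                ≡⟨ cong fromℤ -[1+m]+j≡-[[1+m]+-j] ⟩
    fromℤ (ℤ.- (+[1+ m ] ℤ.+ ℤ.- j))      ≈⟨ fromℤ-homo-neg (+[1+ m ] ℤ.+ ℤ.- j) ⟩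
    - fromℤ (+[1+ m ] ℤ.+ ℤ.- j)          ≈⟨ -‿cong (fromℤ-homo-+ⁿ (suc m) (ℤ.- j)) ⟩
    - (fromℤ +[1+ m ] + fromℤ (ℤ.- j))    ≈⟨ -‿cong (+-congˡ (fromℤ-homo-neg j)) ⟩
    - (fromℤ +[1+ m ] + - fromℤ j)        ≈⟨ ⁻¹-∙-comm _ _ ⟨
    fromℤ -[1+ m ] + - - fromℤ j          ≈⟨ +-congˡ (⁻¹-involutive _) ⟩
    fromℤ -[1+ m ] + fromℤ j              ∎
    where
    -[1+m]+j≡-[[1+m]+-j] : -[1+ m ] ℤ.+ j ≡ ℤ.- (+[1+ m ] ℤ.+ ℤ.- j)
    -[1+m]+j≡-[[1+m]+-j] = ≡.trans (cong (λ k → -[1+ m ] ℤ.+ k) (≡.sym (ℤ.neg-involutive j)))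
                                   (≡.sym (ℤ.neg-distrib-+ +[1+ m ] (ℤ.- j)))

  fromℤ-homo-*ⁿ : ∀ m j → fromℤ (+ m ℤ.* j) ≈ fromℤ (+ m) * fromℤ j
  fromℤ-homo-*ⁿ zero    j = trans (reflexive (cong fromℤ (ℤ.*-zeroˡ j))) (sym (zeroˡ _))
  fromℤ-homo-*ⁿ (suc m) j = begin
    fromℤ (+[1+ m ] ℤ.* j)              ≡⟨ cong fromℤ (ℤ.suc-* (+ m) j) ⟩
    fromℤ (j ℤ.+ + m ℤ.* j)             ≈⟨ fromℤ-homo-+ j _ ⟩
    fromℤ j + fromℤ (+ m ℤ.* j)         ≈⟨ +-congˡ (fromℤ-homo-*ⁿ m j) ⟩
    fromℤ j + fromℤ (+ m) * fromℤ j     ≈⟨ +-congʳ (*-identityˡ _) ⟨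
    1# * fromℤ j + fromℤ (+ m) * fromℤ j ≈⟨ distribʳ _ _ _ ⟨
    (1# + fromℤ (+ m)) * fromℤ j        ≈⟨ *-congʳ (1+× m 1#) ⟨
    fromℤ +[1+ m ] * fromℤ j            ∎

  fromℤ-homo-* : ∀ i j → fromℤ (i ℤ.* j) ≈ fromℤ i * fromℤ j
  fromℤ-homo-* (+ m)    j = fromℤ-homo-*ⁿ m j
  fromℤ-homo-* -[1+ m ] j = begin
    fromℤ (-[1+ m ] ℤ.* j)          ≡⟨ cong fromℤ (ℤ.neg-distribˡ-* +[1+ m ] j) ⟨
    fromℤ (ℤ.- (+[1+ m ] ℤ.* j))    ≈⟨ fromℤ-homo-neg (+[1+ m ] ℤ.* j) ⟩
    - fromℤ (+[1+ m ] ℤ.* j)        ≈⟨ -‿cong (fromℤ-homo-*ⁿ (suc m) j) ⟩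
    - (fromℤ +[1+ m ] * fromℤ j)    ≈⟨ -‿distribˡ-* _ _ ⟩
    fromℤ -[1+ m ] * fromℤ j        ∎

  fromℤ-homomorphism : CommutativeRing.rawRing ℤ.+-*-commutativeRing -Raw-AlmostCommutative⟶ fromCommutativeRing R
  fromℤ-homomorphism = record
    { ⟦_⟧    = fromℤ
    ; +-homo = fromℤ-homo-+
    ; *-homo = fromℤ-homo-*
    ; -‿homo = fromℤ-homo-neg
    ; 0-homo = refl
    ; 1-homo = refl
    }

  fromℤ-≟ : ∀ i j → Maybe (fromℤ i ≈ fromℤ j)
  fromℤ-≟ i j with i ℤ.≟ j
  ... | yes ≡.refl = just refl
  ... | no _       = nothing

  open import Algebra.Solver.Ring _ _ fromℤ-homomorphism fromℤ-≟ public

module _ {c ℓ : Level} (R : CommutativeRing c ℓ) where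
  open CommutativeRing R
  open IntegerCoefficients R using (solve; _:=_; _:+_; _:*_; _:-_; :-_; con)
  open import Algebra.Properties.CommutativeSemigroup +-commutativeSemigroup using (interchange)
  open import Relation.Binary.Reasoning.Setoid setoid

  natCast-homo-+ : ∀ m n → natCast R (m ℕ.+ n) ≈ natCast R m + natCast R n
  natCast-homo-+ zero    n = sym (+-identityˡ _)
  natCast-homo-+ (suc m) n = trans (+-congˡ (natCast-homo-+ m n)) (sym (+-assoc _ _ _))

  natCast-homo-* : ∀ m n → natCast R (m ℕ.* n) ≈ natCast R m * natCast R n
  natCast-homo-* zero    n = sym (zeroˡ _)
  natCast-homo-* (suc m) n = begin
    natCast R (n ℕ.+ m ℕ.* n)                     ≈⟨ natCast-homo-+ n (m ℕ.* n) ⟩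
    natCast R n + natCast R (m ℕ.* n)             ≈⟨ +-congˡ (natCast-homo-* m n) ⟩
    natCast R n + natCast R m * natCast R n       ≈⟨ +-congʳ (*-identityˡ _) ⟨
    1# * natCast R n + natCast R m * natCast R n  ≈⟨ distribʳ _ _ _ ⟨
    (1# + natCast R m) * natCast R n              ∎

  sumTo-cong : ∀ n {f g : ℕ → Carrier} → (∀ j → j ≤ n → f j ≈ g j) → sumTo R n f ≈ sumTo R n g
  sumTo-cong zero    f≈g = f≈g 0 ℕ.z≤n
  sumTo-cong (suc n) f≈g =
    +-cong (sumTo-cong n (λ j j≤n → f≈g j (ℕ.m≤n⇒m≤1+n j≤n))) (f≈g (suc n) ℕ.≤-refl)

  sumTo-distrib-+ : ∀ n f g → sumTo R n (λ j → f j + g j) ≈ sumTo R n f + sumTo R n g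
  sumTo-distrib-+ zero    f g = refl
  sumTo-distrib-+ (suc n) f g = trans (+-congʳ (sumTo-distrib-+ n f g)) (interchange _ _ _ _)

  *-distribˡ-sumTo : ∀ n x f → x * sumTo R n f ≈ sumTo R n (λ j → x * f j)
  *-distribˡ-sumTo zero    x f = refl
  *-distribˡ-sumTo (suc n) x f = trans (distribˡ _ _ _) (+-congʳ (*-distribˡ-sumTo n x f))

  sumTo-shift : ∀ n f → sumTo R (suc n) f ≈ f 0 + sumTo R n (λ j → f (suc j))
  sumTo-shift zero    f = refl
  sumTo-shift (suc n) f = trans (+-congʳ (sumTo-shift n f)) (+-assoc _ _ _)

  progression : Carrier → Carrier → ℕ → Carrier
  progression a d zero    = a
  progression a d (suc q) = progression a d q + d

  progression-closed : ∀ a d q → progression a d q ≈ a + natCast R q * d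
  progression-closed a d zero    = solve 2 (λ a d → a := a :+ con (+ 0) :* d) refl a d
  progression-closed a d (suc q) = trans (+-congʳ (progression-closed a d q))
    (solve 3 (λ a d n → a :+ n :* d :+ d := a :+ (con (+ 1) :+ n) :* d) refl a d (natCast R q))

  degFall-neg : ∀ λ' y m → degFall R λ' (- y) m ≈ pow R (- 1#) m * degRise R λ' y m
  degFall-neg λ' y zero    = sym (*-identityˡ 1#)
  degFall-neg λ' y (suc m) = trans (*-congʳ (degFall-neg λ' y m))
    (solve 5 (λ s r y n l → s :* r :* (:- y :- n :* l) := s :* (:- con (+ 1)) :* (r :* (y :+ n :* l)))
      refl (pow R (- 1#) m) (degRise R λ' y m) y (natCast R m) λ')

  module _ (λ' : Carrier) where

    degFall-shift : ∀ y m → degFall R λ' (y + λ') (suc m) ≈ (y + λ') * degFall R λ' y m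
    degFall-shift y zero    =
      solve 2 (λ y l → con (+ 1) :* (y :+ l :- con (+ 0) :* l) := (y :+ l) :* con (+ 1)) refl y λ'
    degFall-shift y (suc m) = trans (*-congʳ (degFall-shift y m))
      (solve 4 (λ y l f n → (y :+ l) :* f :* (y :+ l :- (con (+ 1) :+ n) :* l) := (y :+ l) :* (f :* (y :- n :* l)))
        refl y λ' (degFall R λ' y m) (natCast R m))

    binomFall : Carrier → ℕ → ℕ → Carrier
    binomFall y p j = natCast R (p C j) * degFall R λ' y (p ∸ j)

    binomFall-zero : ∀ y p → binomFall y (suc p) 0 ≈ (y - natCast R p * λ') * binomFall y p 0
    binomFall-zero y p = solve 3 (λ c f a → c :* (f :* a) := a :* (c :* f))
      refl (natCast R 1) (degFall R λ' y p) (y - natCast R p * λ')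

    binomFall-over : ∀ y p → binomFall y p (suc p) ≈ 0#
    binomFall-over y p =
      trans (*-congʳ (reflexive (cong (natCast R) (k>n⇒nCk≡0 (ℕ.n<1+n p))))) (zeroˡ _)

    -- With ci = C(p,i), cs = C(p,i+1), ni = i, nm = p-i-1 the hypothesis is the
    -- absorption identity, and the conclusion is binomFall-suc divided by (y)_{p-i-1,λ}.
    pascal-identity : ∀ y f ci cs ni nm → ci * (1# + nm) ≈ cs * (1# + ni) →
      (ci + cs) * (f * (y - nm * λ')) ≈ (y - (1# + (ni + nm)) * λ') * (cs * f) + ci * ((y + λ') * f)
    pascal-identity y f ci cs ni nm absorb = begin
      (ci + cs) * (f * (y - nm * λ'))
        ≈⟨ solve 7 (λ y f ci cs ni nm l → (ci :+ cs) :* (f :* (y :- nm :* l))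
             := (y :- (con (+ 1) :+ (ni :+ nm)) :* l) :* (cs :* f) :+ ci :* ((y :+ l) :* f)
                :+ l :* f :* (cs :* (con (+ 1) :+ ni) :- ci :* (con (+ 1) :+ nm)))
             refl y f ci cs ni nm λ' ⟩
      rhs + λ' * f * (cs * (1# + ni) - ci * (1# + nm))
        ≈⟨ +-congˡ (*-congˡ (+-congˡ (-‿cong absorb))) ⟩
      rhs + λ' * f * (cs * (1# + ni) - cs * (1# + ni))
        ≈⟨ solve 4 (λ r l f z → r :+ l :* f :* (z :- z) := r) refl rhs λ' f (cs * (1# + ni)) ⟩
      rhs ∎
      where
      rhs = (y - (1# + (ni + nm)) * λ') * (cs * f) + ci * ((y + λ') * f)

    binomFall-suc : ∀ y {p i} → i ≤ p →
      binomFall y (suc p) (suc i) ≈ (y - natCast R p * λ') * binomFall y p (suc i) + binomFall (y + λ') p i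
    binomFall-suc y {p} {i} i≤p with ℕ.m≤n⇒m<n∨m≡n i≤p
    ... | inj₂ ≡.refl
      rewrite nCn≡1 p | nCn≡1 (suc p) | k>n⇒nCk≡0 (ℕ.n<1+n p) | ℕ.n∸n≡0 p
      = solve 3 (λ a f x → x := a :* (con (+ 0) :* f) :+ x)
          refl (y - natCast R p * λ') (degFall R λ' y (p ∸ suc p)) (natCast R 1 * 1#)
    ... | inj₁ i<p = begin
      natCast R (suc p C suc i) * degFall R λ' y (p ∸ i)
        ≡⟨ ≡.cong₂ (λ c k → natCast R c * degFall R λ' y k) (≡.sym (nCk+nC[k+1]≡[n+1]C[k+1] p i)) p∸i≡1+m ⟩
      natCast R ((p C i) ℕ.+ (p C suc i)) * (F m * (y - nm * λ'))
        ≈⟨ *-congʳ (natCast-homo-+ (p C i) (p C suc i)) ⟩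
      (ci + cs) * (F m * (y - nm * λ'))
        ≈⟨ pascal-identity y (F m) ci cs ni nm absorb ⟩
      (y - (1# + (ni + nm)) * λ') * (cs * F m) + ci * ((y + λ') * F m)
        ≈⟨ +-cong (*-congʳ (+-congˡ (-‿cong (*-congʳ natCast-p)))) (*-congˡ (degFall-shift y m)) ⟨
      (y - natCast R p * λ') * (cs * F m) + ci * degFall R λ' (y + λ') (suc m)
        ≡⟨ cong (λ k → (y - natCast R p * λ') * (cs * F m) + ci * degFall R λ' (y + λ') k) p∸i≡1+m ⟨
      (y - natCast R p * λ') * binomFall y p (suc i) + binomFall (y + λ') p i ∎
      where
      m  = p ∸ suc i
      F  = degFall R λ' y
      ci = natCast R (p C i)
      cs = natCast R (p C suc i)
      ni = natCast R i
      nm = natCast R m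
      p∸i≡1+m : p ∸ i ≡ suc m
      p∸i≡1+m = ℕ.+-∸-assoc 1 i<p
      natCast-p : natCast R p ≈ 1# + (ni + nm)
      natCast-p = trans (reflexive (cong (natCast R) (≡.sym (ℕ.m+[n∸m]≡n i<p)))) (+-congˡ (natCast-homo-+ i m))
      absorb : ci * (1# + nm) ≈ cs * (1# + ni)
      absorb = begin
        ci * natCast R (suc m)              ≈⟨ natCast-homo-* (p C i) (suc m) ⟨
        natCast R ((p C i) ℕ.* suc m)       ≡⟨ cong (λ k → natCast R ((p C i) ℕ.* k)) p∸i≡1+m ⟨
        natCast R ((p C i) ℕ.* (p ∸ i))     ≡⟨ cong (natCast R) (nCk*[n∸k]≡nC[1+k]*[1+k] p i) ⟩
        natCast R ((p C suc i) ℕ.* suc i)   ≈⟨ natCast-homo-* (p C suc i) (suc i) ⟩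
        cs * natCast R (suc i)              ∎

    module _ (y₀ : Carrier) (x : ℕ → Carrier) where

      binomialTerm : ℕ → ℕ → ℕ → Carrier
      binomialTerm p q j = binomFall (progression y₀ λ' q) p j * x (q ℕ.+ j)

      binomialSum : ℕ → ℕ → Carrier
      binomialSum p q = sumTo R p (binomialTerm p q)

      binomialSum-zero : ∀ q → binomialSum 0 q ≈ x q
      binomialSum-zero q = trans (*-congʳ (trans (*-identityʳ _) (+-identityʳ 1#)))
                                 (trans (*-identityˡ _) (reflexive (cong x (ℕ.+-identityʳ q))))

      module _ (p q : ℕ) where
        private
          y = progression y₀ λ' q
          a = y - natCast R p * λ'

        binomialTerm-suc-zero : binomialTerm (suc p) q 0 ≈ a * binomialTerm p q 0
        binomialTerm-suc-zero = trans (*-congʳ (binomFall-zero y p)) (*-assoc _ _ _)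

        binomialTerm-suc : ∀ {j} → j ≤ p →
          binomialTerm (suc p) q (suc j) ≈ a * binomialTerm p q (suc j) + binomialTerm p (suc q) j
        binomialTerm-suc {j} j≤p = begin
          binomFall y (suc p) (suc j) * x (q ℕ.+ suc j)
            ≈⟨ *-congʳ (binomFall-suc y j≤p) ⟩
          (a * binomFall y p (suc j) + binomFall (y + λ') p j) * x (q ℕ.+ suc j)
            ≈⟨ distribʳ _ _ _ ⟩
          a * binomFall y p (suc j) * x (q ℕ.+ suc j) + binomFall (y + λ') p j * x (q ℕ.+ suc j)
            ≈⟨ +-cong (*-assoc _ _ _) (reflexive (cong (λ k → binomFall (y + λ') p j * x k) (ℕ.+-suc q j))) ⟩
          a * binomialTerm p q (suc j) + binomialTerm p (suc q) j ∎

        binomialTerm-over : a * binomialTerm p q (suc p) ≈ 0#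
        binomialTerm-over = trans (*-congˡ (trans (*-congʳ (binomFall-over y p)) (zeroˡ _))) (zeroʳ _)

        binomialSum-suc : binomialSum (suc p) q ≈ a * binomialSum p q + binomialSum p (suc q)
        binomialSum-suc = begin
          sumTo R (suc p) (T (suc p) q)
            ≈⟨ sumTo-shift p (T (suc p) q) ⟩
          T (suc p) q 0 + sumTo R p (λ j → T (suc p) q (suc j))
            ≈⟨ +-cong binomialTerm-suc-zero (sumTo-cong p (λ _ → binomialTerm-suc)) ⟩
          a * T p q 0 + sumTo R p (λ j → a * T p q (suc j) + T p (suc q) j)
            ≈⟨ +-congˡ (sumTo-distrib-+ p _ _) ⟩
          a * T p q 0 + (sumTo R p (λ j → a * T p q (suc j)) + binomialSum p (suc q))
            ≈⟨ +-assoc _ _ _ ⟨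
          a * T p q 0 + sumTo R p (λ j → a * T p q (suc j)) + binomialSum p (suc q)
            ≈⟨ +-congʳ (sumTo-shift p (λ j → a * T p q j)) ⟨
          sumTo R p (λ j → a * T p q j) + a * T p q (suc p) + binomialSum p (suc q)
            ≈⟨ +-congʳ (trans (+-congˡ binomialTerm-over) (+-identityʳ _)) ⟩
          sumTo R p (λ j → a * T p q j) + binomialSum p (suc q)
            ≈⟨ +-congʳ (*-distribˡ-sumTo p a (T p q)) ⟨
          a * binomialSum p q + binomialSum p (suc q) ∎
          where
          T = binomialTerm

    expansion : ∀ y₀ (M : ℕ → ℕ → Carrier) →
      (∀ p q → M (suc p) q ≈ (y₀ + (natCast R q - natCast R p) * λ') * M p q + M p (suc q)) →
      ∀ p q → M p q ≈ binomialSum y₀ (M 0) p q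
    expansion y₀ M M-rec zero    q = sym (binomialSum-zero y₀ (M 0) q)
    expansion y₀ M M-rec (suc p) q = begin
      M (suc p) q
        ≈⟨ M-rec p q ⟩
      (y₀ + (natCast R q - natCast R p) * λ') * M p q + M p (suc q)
        ≈⟨ +-cong (*-cong coefficient (expansion y₀ M M-rec p q)) (expansion y₀ M M-rec p (suc q)) ⟩
      (progression y₀ λ' q - natCast R p * λ') * S p q + S p (suc q)
        ≈⟨ binomialSum-suc y₀ (M 0) p q ⟨
      S (suc p) q ∎
      where
      S = binomialSum y₀ (M 0)
      coefficient : y₀ + (natCast R q - natCast R p) * λ' ≈ progression y₀ λ' q - natCast R p * λ'
      coefficient = trans
        (solve 4 (λ a l nq np → a :+ (nq :- np) :* l := a :+ nq :* l :- np :* l) refl y₀ λ' (natCast R q) (natCast R p))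
        (+-congʳ (sym (progression-closed y₀ λ' q)))

  eulerSeidel-rec : ∀ λ' a p q → eulerSeidel R λ' a (suc p) q
    ≈ ((1# - λ') + (natCast R q - natCast R p) * λ') * eulerSeidel R λ' a p q + eulerSeidel R λ' a p (suc q)
  eulerSeidel-rec λ' a p q = +-congʳ (*-congʳ
    (solve 3 (λ l np nq → con (+ 1) :- (con (+ 1) :+ np) :* l :+ nq :* l := con (+ 1) :- l :+ (nq :- np) :* l)
      refl λ' (natCast R p) (natCast R q)))

  eulerSeidel-transpose-rec : ∀ λ' a p q → eulerSeidel R λ' a q (suc p)
    ≈ (- (1# - λ') + (natCast R q - natCast R p) * λ') * eulerSeidel R λ' a q p + eulerSeidel R λ' a (suc q) p
  eulerSeidel-transpose-rec λ' a p q = sym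
    (solve 5 (λ l nq np e e′ → (:- (con (+ 1) :- l) :+ (nq :- np) :* l) :* e
                                  :+ ((con (+ 1) :- (con (+ 1) :+ nq) :* l :+ np :* l) :* e :+ e′) := e′)
      refl λ' (natCast R q) (natCast R p) (eulerSeidel R λ' a q p) (eulerSeidel R λ' a q (suc p)))

theorem3p1 : ∀ {c ℓ : Level} (R : CommutativeRing c ℓ) →
    let open CommutativeRing R in
    (λ' : Carrier) → ¬ (λ' ≈ 0#) → (a : ℕ → Carrier) → (n : ℕ) →
      (eulerSeidel R λ' a n 0
        ≈ sumTo R n (λ k → natCast R (n C k) * degFall R λ' (1# - λ') (n ∸ k) * eulerSeidel R λ' a 0 k))
      ×
      (eulerSeidel R λ' a 0 n
        ≈ sumTo R n (λ k → natCast R (n C k) * pow R (- 1#) (n ∸ k) * degRise R λ' (1# - λ') (n ∸ k) * eulerSeidel R λ' a k 0))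
theorem3p1 R λ' _ a n =
    expansion R λ' (1# - λ') (eulerSeidel R λ' a) (eulerSeidel-rec R λ' a) n 0
  , trans (expansion R λ' (- (1# - λ')) (λ p q → eulerSeidel R λ' a q p) (eulerSeidel-transpose-rec R λ' a) n 0)
          (sumTo-cong R n (λ k _ → *-congʳ (trans (*-congˡ (degFall-neg R λ' (1# - λ') (n ∸ k))) (sym (*-assoc _ _ _)))))
  where open CommutativeRing R
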